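{- Let $(a(n))_{n\ge 1}$ be the sequence of positive integers defined by $a(1)=1$, $a(2)=2$, and, for $n\ge 2$, $a(n+1)$ is the smallest positive integer $m$ such that $m\notin\{a(1),\dots,a(n)\}$ and $\gcd(m,a(n))>1$. Then every positive integer occurs in the sequence, i.e. for every positive integer $k$ there is an $n$ with $a(n)=k$.
   Context: This sequence is called the EKG sequence (OEIS A064413); it begins $1,2,4,6,3,9,12,8,10,5,15,18,14,7,21,24,16,20,\dots$. -}

module Defs where

open import Data.Nat using (ℕ; suc; _≤_; _<_)
open import Data.Nat.GCD using (gcd)
open import Data.Product using (_×_; ∃-syntax)
open import Relation.Nullary using (¬_)
open import Relation.Binary.PropositionalEquality using (_≡_)

-- Sequences are functions ℕ → ℕ indexed from 1; the value at 0 is irrelevant.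

Occurs≤ : (ℕ → ℕ) → ℕ → ℕ → Set
Occurs≤ a n m = ∃[ i ] (1 ≤ i × i ≤ n × a i ≡ m)

Candidate : (ℕ → ℕ) → ℕ → ℕ → Set
Candidate a n m = 1 ≤ m × ¬ Occurs≤ a n m × 1 < gcd m (a n)

IsEKG : (ℕ → ℕ) → Set
IsEKG a = a 1 ≡ 1 × a 2 ≡ 2 ×
  (∀ n → 2 ≤ n → Candidate a n (a (suc n)) × (∀ m → Candidate a n m → a (suc n) ≤ m))

-- If p divides
-- a(n) for infinitely many n, then every positive multiple m of p occurs: otherwise m
-- is a candidate after each of these terms, so infinitely many distinct terms are ≤ m.
-- So it suffices that even terms are unbounded: then every even number occurs, hence
-- every k divides the infinitely many terms 2k, 4k, 6k, …, and k itself occurs.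
--
-- Suppose every even term among the first N terms is below an even C.  When a(n) and
-- a(n+1) share a prime q, the unused candidate qC shows a(n+1) < qC.  So in a run of
-- C+1 consecutive terms all ≥ C², the prime shared by the first two is some p > C that
-- divides every later term of the run with cofactor < C; by pigeonhole this is
-- impossible.  Hence each of C²+1 disjoint such runs contains a term < C², again
-- contradicting pigeonhole once N is large enough.
module Submission where

open import Defs
open import Data.Nat using (ℕ; _≤_)
open import Data.Product using (_×_; ∃-syntax)
open import Relation.Binary.PropositionalEquality using (_≡_)

open import Data.Nat.Base
  using ( zero; suc; _+_; _*_; _<_; _⊔_; _/_; z≤n; s≤s; z<s
        ; NonZero; >-nonZero⁻¹; ≢-nonZero; nonTrivial⇒n>1 )
open import Data.Nat.Properties
open import Data.Nat.DivMod using (+-distrib-/-∣ˡ; m*n/n≡m; m<n⇒m/n≡0)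
open import Data.Nat.Divisibility
open import Data.Nat.GCD using (gcd; gcd[m,n]∣m; gcd[m,n]∣n; gcd-greatest; gcd[m,n]≢0)
open import Data.Nat.Primality using (Prime; euclidsLemma; prime⇒nonTrivial; prime⇒irreducible)
open import Data.Nat.Primality.Factorisation using (factorise)
open import Data.Nat.ListAction using (product)
open import Data.List.Base using ([]; _∷_)
open import Data.List.Relation.Unary.All using (_∷_)
import Data.Fin.Base as Fin
open import Data.Fin.Properties using (toℕ<n; toℕ-fromℕ<) renaming (pigeonhole to Fin-pigeonhole)
open import Data.Product using (_,_; proj₁; proj₂; map₂; ∃₂)
open import Data.Sum.Base using (inj₁; inj₂)
open import Data.Empty using (⊥)
open import Function.Base using (_∘_)
open import Relation.Nullary using (¬_; Dec; yes; no; contradiction)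
open import Relation.Nullary.Decidable using (_×-dec_; decidable-stable)
open import Relation.Binary.Definitions using (tri<; tri≈; tri>)
open import Relation.Binary.PropositionalEquality
  using (_≢_; refl; sym; trans; cong; cong₂; subst; module ≡-Reasoning)

prime⇒2≤ : ∀ {p} → Prime p → 2 ≤ p
prime⇒2≤ {p} p-prime = nonTrivial⇒n>1 p {{prime⇒nonTrivial p-prime}}

prime-divisor≡ : ∀ {p q} → Prime p → q ∣ p → 1 < q → q ≡ p
prime-divisor≡ p-prime q∣p 1<q with prime⇒irreducible p-prime q∣p
... | inj₁ q≡1 = contradiction q≡1 (>⇒≢ 1<q)
... | inj₂ q≡p = q≡p

∃-prime-divisor : ∀ {n} → 1 < n → ∃[ p ] Prime p × p ∣ n
∃-prime-divisor {suc n} 1<n with factorise (suc n)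
... | record { factors = [] ; isFactorisation = n≡1 } = contradiction n≡1 (>⇒≢ 1<n)
... | record { factors = p ∷ ps ; isFactorisation = n≡pΠps ; factorsPrime = p-prime ∷ _ } =
  p , p-prime , subst (p ∣_) (sym n≡pΠps) (m∣m*n (product ps))

∃-common-prime-divisor : ∀ {m n} → 1 < gcd m n → ∃[ p ] Prime p × p ∣ m × p ∣ n
∃-common-prime-divisor {m} {n} 1<gcd with ∃-prime-divisor 1<gcd
... | p , p-prime , p∣gcd =
  p , p-prime , ∣-trans p∣gcd (gcd[m,n]∣m m n) , ∣-trans p∣gcd (gcd[m,n]∣n m n)

common-divisor⇒1<gcd : ∀ {d m n} → 1 < d → d ∣ m → d ∣ n → 1 ≤ m → 1 < gcd m n
common-divisor⇒1<gcd {d} {m} {n} 1<d d∣m d∣n 1≤m =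
  <-≤-trans 1<d (∣⇒≤ {{≢-nonZero (gcd[m,n]≢0 m n (inj₁ (>⇒≢ 1≤m)))}} (gcd-greatest d∣m d∣n))

∣∧<⇒≡0 : ∀ {m n} → m ∣ n → n < m → n ≡ 0
∣∧<⇒≡0 {n = zero}  _   _   = refl
∣∧<⇒≡0 {n = suc _} m∣n n<m = contradiction (∣⇒≤ m∣n) (<⇒≱ n<m)

[m*n+o]/n≡m : ∀ m {n o} .{{_ : NonZero n}} → o < n → (m * n + o) / n ≡ m
[m*n+o]/n≡m m {n} {o} o<n = begin
  (m * n + o) / n   ≡⟨ +-distrib-/-∣ˡ o (n∣m*n m) ⟩
  m * n / n + o / n ≡⟨ cong₂ _+_ (m*n/n≡m m n) (m<n⇒m/n≡0 o<n) ⟩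
  m + 0             ≡⟨ +-identityʳ m ⟩
  m                 ∎
  where open ≡-Reasoning

maxUpTo : (ℕ → ℕ) → ℕ → ℕ
maxUpTo f zero    = f zero
maxUpTo f (suc n) = maxUpTo f n ⊔ f (suc n)

≤-maxUpTo : ∀ f {n i} → i ≤ n → f i ≤ maxUpTo f n
≤-maxUpTo f {zero}  z≤n = ≤-refl
≤-maxUpTo f {suc n} i≤1+n with m≤n⇒m<n∨m≡n i≤1+n
... | inj₁ (s≤s i≤n) = ≤-trans (≤-maxUpTo f i≤n) (m≤m⊔n _ _)
... | inj₂ refl      = m≤n⊔m _ _

step-increasing⇒<-mono : ∀ (f : ℕ → ℕ) → (∀ n → f n < f (suc n)) →
                         ∀ {m n} → m < n → f m < f n
step-increasing⇒<-mono f step {m} {suc n} (s≤s m≤n) with m≤n⇒m<n∨m≡n m≤n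
... | inj₁ m<n = <-trans (step-increasing⇒<-mono f step m<n) (step n)
... | inj₂ refl = step m

step-increasing⇒injective : ∀ (f : ℕ → ℕ) → (∀ n → f n < f (suc n)) →
                            ∀ {m n} → f m ≡ f n → m ≡ n
step-increasing⇒injective f step {m} {n} fm≡fn with <-cmp m n
... | tri< m<n _ _ = contradiction fm≡fn (<⇒≢ (step-increasing⇒<-mono f step m<n))
... | tri≈ _ m≡n _ = m≡n
... | tri> _ _ n<m = contradiction fm≡fn (>⇒≢ (step-increasing⇒<-mono f step n<m))

pigeonhole : ∀ n (R : ℕ → ℕ → Set) →
             (∀ i → i ≤ n → ∃[ v ] v < n × R i v) →
             (∀ {i j v} → i ≤ n → j ≤ n → R i v → R j v → i ≡ j) → ⊥
pigeonhole n R image R-injective = collision (Fin-pigeonhole ≤-refl f)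
  where
    bound : (i : Fin.Fin (suc n)) → Fin.toℕ i ≤ n
    bound i = ≤-pred (toℕ<n i)
    value : Fin.Fin (suc n) → ℕ
    value i = proj₁ (image (Fin.toℕ i) (bound i))
    f : Fin.Fin (suc n) → Fin.Fin n
    f i = Fin.fromℕ< (proj₁ (proj₂ (image (Fin.toℕ i) (bound i))))
    related : ∀ i → R (Fin.toℕ i) (value i)
    related i = proj₂ (proj₂ (image (Fin.toℕ i) (bound i)))
    collision : ∃₂ (λ i j → i Fin.< j × f i ≡ f j) → ⊥
    collision (i , j , i<j , fᵢ≡fⱼ) =
      <-irrefl (R-injective (bound i) (bound j) (subst (R (Fin.toℕ i)) vᵢ≡vⱼ (related i)) (related j))
               i<j
      where
        vᵢ≡vⱼ : value i ≡ value j
        vᵢ≡vⱼ = trans (sym (toℕ-fromℕ< _)) (trans (cong Fin.toℕ fᵢ≡fⱼ) (toℕ-fromℕ< _))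

Occurs : (ℕ → ℕ) → ℕ → Set
Occurs a m = ∃[ n ] (1 ≤ n × a n ≡ m)

occurs≤? : ∀ a N m → Dec (Occurs≤ a N m)
occurs≤? a N m with anyUpTo? (λ i → (1 ≤? i) ×-dec (a i ≟ m)) (suc N)
... | yes (i , i<1+N , 1≤i , aᵢ≡m) = yes (i , 1≤i , ≤-pred i<1+N , aᵢ≡m)
... | no ¬occurs = no λ (i , 1≤i , i≤N , aᵢ≡m) → ¬occurs (i , s≤s i≤N , 1≤i , aᵢ≡m)

Occurs≤-mono : ∀ {a N N' m} → N ≤ N' → Occurs≤ a N m → Occurs≤ a N' m
Occurs≤-mono N≤N' (i , 1≤i , i≤N , aᵢ≡m) = i , 1≤i , ≤-trans i≤N N≤N' , aᵢ≡m

Occurs≤⇒Occurs : ∀ {a N m} → Occurs≤ a N m → Occurs a m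
Occurs≤⇒Occurs (i , 1≤i , _ , aᵢ≡m) = i , 1≤i , aᵢ≡m

-- Room for C² + 1 disjoint windows of C + 1 consecutive terms after a(2).
horizon : ℕ → ℕ
horizon C = 3 + suc (C * C) * suc C

module EKG (a : ℕ → ℕ) (ekg : IsEKG a) where

  a[1]≡1 : a 1 ≡ 1
  a[1]≡1 = proj₁ ekg

  a[2]≡2 : a 2 ≡ 2
  a[2]≡2 = proj₁ (proj₂ ekg)

  next-candidate : ∀ {n} → 2 ≤ n → Candidate a n (a (suc n))
  next-candidate 2≤n = proj₁ (proj₂ (proj₂ ekg) _ 2≤n)

  next-minimal : ∀ {n} → 2 ≤ n → ∀ {m} → Candidate a n m → a (suc n) ≤ m
  next-minimal 2≤n = proj₂ (proj₂ (proj₂ ekg) _ 2≤n) _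

  a-fresh : ∀ {i j} → 1 ≤ i → i < j → a i ≢ a j
  a-fresh {j = suc (suc (suc n))} 1≤i i<j aᵢ≡aⱼ =
    proj₁ (proj₂ (next-candidate (s≤s (s≤s z≤n)))) (_ , 1≤i , ≤-pred i<j , aᵢ≡aⱼ)
  a-fresh {suc zero} {suc (suc zero)} _ _ a₁≡a₂ =
    contradiction (trans (sym a[1]≡1) (trans a₁≡a₂ a[2]≡2)) λ ()
  a-fresh {suc (suc _)} {suc (suc zero)} _ (s≤s (s≤s ())) _
  a-fresh {suc _} {suc zero} _ (s≤s ()) _

  ∃-prime-shared-with-next : ∀ {n} → 2 ≤ n → ∃[ q ] Prime q × q ∣ a (suc n) × q ∣ a n
  ∃-prime-shared-with-next 2≤n = ∃-common-prime-divisor (proj₂ (proj₂ (next-candidate 2≤n)))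

  a-injective : ∀ {i j} → 1 ≤ i → 1 ≤ j → a i ≡ a j → i ≡ j
  a-injective {i} {j} 1≤i 1≤j aᵢ≡aⱼ with <-cmp i j
  ... | tri< i<j _ _ = contradiction aᵢ≡aⱼ (a-fresh 1≤i i<j)
  ... | tri≈ _ i≡j _ = i≡j
  ... | tri> _ _ j<i = contradiction (sym aᵢ≡aⱼ) (a-fresh 1≤j j<i)

  even-index≥2 : ∀ {n} → 1 ≤ n → 2 ∣ a n → 2 ≤ n
  even-index≥2 {suc zero}    _ 2∣a₁ = contradiction (∣⇒≤ (subst (2 ∣_) a[1]≡1 2∣a₁)) λ { (s≤s ()) }
  even-index≥2 {suc (suc _)} _ _    = s≤s (s≤s z≤n)

  record DividesInfinitelyOften (p : ℕ) : Set where
    field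
      index           : ℕ → ℕ
      index-injective : ∀ {i j} → index i ≡ index j → i ≡ j
      2≤index         : ∀ j → 2 ≤ index j
      p∣a[index]      : ∀ j → p ∣ a (index j)

  -- If m were missing from a(1), …, a(N), it would be a candidate after each of m+2
  -- terms divisible by p, bounding their m+2 distinct successors by m.
  multiples-occur : ∀ {p} → 1 < p → DividesInfinitelyOften p →
                    ∀ {m} → 1 ≤ m → p ∣ m → Occurs a m
  multiples-occur {p} 1<p often {m} 1≤m p∣m =
    Occurs≤⇒Occurs (decidable-stable (occurs≤? a N m) missing⇒⊥)
    where
      open DividesInfinitelyOften often
      N : ℕ
      N = maxUpTo index (suc m)
      missing⇒⊥ : ¬ ¬ Occurs≤ a N m
      missing⇒⊥ missing = pigeonhole (suc m) (λ j v → a (suc (index j)) ≡ v)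
        (λ j j≤1+m → a (suc (index j)) , s≤s (successor≤m j≤1+m) , refl)
        (λ _ _ eᵢ eⱼ → index-injective
           (suc-injective (a-injective (s≤s z≤n) (s≤s z≤n) (trans eᵢ (sym eⱼ)))))
        where
          successor≤m : ∀ {j} → j ≤ suc m → a (suc (index j)) ≤ m
          successor≤m {j} j≤1+m = next-minimal (2≤index j)
            ( 1≤m
            , missing ∘ Occurs≤-mono (≤-maxUpTo index j≤1+m)
            , common-divisor⇒1<gcd 1<p p∣m (p∣a[index] j) 1≤m )

  module SmallEvenTerms (C : ℕ) .{{_ : NonZero C}} (2∣C : 2 ∣ C)
           (small : ∀ {i} → 1 ≤ i → i ≤ horizon C → 2 ∣ a i → a i < C) where

    0<C² : 0 < C * C
    0<C² = *-mono-< (>-nonZero⁻¹ C) (>-nonZero⁻¹ C)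

    large-even-unused : ∀ {x} → 2 ∣ x → C ≤ x → ¬ Occurs≤ a (horizon C) x
    large-even-unused 2∣x C≤x (i , 1≤i , i≤h , aᵢ≡x) =
      <⇒≱ (small 1≤i i≤h (subst (2 ∣_) (sym aᵢ≡x) 2∣x)) (subst (C ≤_) (sym aᵢ≡x) C≤x)

    next<q*C : ∀ {n q} → 2 ≤ n → suc n ≤ horizon C → 1 < q → q ∣ a n → a (suc n) < q * C
    next<q*C {n} {q} 2≤n 1+n≤h 1<q q∣aₙ =
      ≤∧≢⇒< (next-minimal 2≤n qC-candidate)
            (λ aₙ₊₁≡qC → large-even-unused 2∣qC C≤qC (suc n , s≤s z≤n , 1+n≤h , aₙ₊₁≡qC))
      where
        2∣qC : 2 ∣ q * C
        2∣qC = ∣-trans 2∣C (n∣m*n q)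
        C≤qC : C ≤ q * C
        C≤qC = m≤n*m C q {{≢-nonZero (>⇒≢ (<-trans z<s 1<q))}}
        qC-candidate : Candidate a n (q * C)
        qC-candidate =
          ( ≤-trans (>-nonZero⁻¹ C) C≤qC
          , large-even-unused 2∣qC C≤qC ∘ Occurs≤-mono (≤-trans (n≤1+n n) 1+n≤h)
          , common-divisor⇒1<gcd 1<q (m∣m*n C) q∣aₙ (≤-trans (>-nonZero⁻¹ C) C≤qC) )

    SmallMultiple : ℕ → ℕ → Set
    SmallMultiple p x = ∃[ c ] c < C × x ≡ p * c

    ∣∧<⇒SmallMultiple : ∀ {p x} → p ∣ x → x < p * C → SmallMultiple p x
    ∣∧<⇒SmallMultiple {p} p∣x x<pC =
      quotient p∣x , *-cancelˡ-< p _ C (subst (_< p * C) x≡pc x<pC) , x≡pc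
      where x≡pc = m∣n⇒n≡m*quotient p∣x

    -- The prime q shared by a(n) and a(n+1) exceeds C since C² ≤ a(n+1) < qC, so it
    -- cannot divide the cofactor of a(n); Euclid then forces q = p.
    prime-persists : ∀ {n p} → Prime p → 2 ≤ n → suc n ≤ horizon C →
                     C * C ≤ a n → C * C ≤ a (suc n) →
                     SmallMultiple p (a n) → SmallMultiple p (a (suc n))
    prime-persists {n} {p} p-prime 2≤n 1+n≤h C²≤aₙ C²≤aₙ₊₁ (c , c<C , aₙ≡pc)
      with q , q-prime , q∣aₙ₊₁ , q∣aₙ ← ∃-prime-shared-with-next 2≤n
      = subst (λ r → SmallMultiple r (a (suc n))) q≡p (∣∧<⇒SmallMultiple q∣aₙ₊₁ aₙ₊₁<qC)
      where
        aₙ₊₁<qC : a (suc n) < q * C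
        aₙ₊₁<qC = next<q*C 2≤n 1+n≤h (prime⇒2≤ q-prime) q∣aₙ
        C<q : C < q
        C<q = *-cancelʳ-< C C q (≤-<-trans C²≤aₙ₊₁ aₙ₊₁<qC)
        q∤c : ¬ q ∣ c
        q∤c q∣c = <⇒≱ 0<C² (subst (C * C ≤_) aₙ≡0 C²≤aₙ)
          where
            aₙ≡0 : a n ≡ 0
            aₙ≡0 = begin
              a n   ≡⟨ aₙ≡pc ⟩
              p * c ≡⟨ cong (p *_) (∣∧<⇒≡0 q∣c (<-trans c<C C<q)) ⟩
              p * 0 ≡⟨ *-zeroʳ p ⟩
              0     ∎
              where open ≡-Reasoning
        q≡p : q ≡ p
        q≡p with euclidsLemma p c q-prime (subst (q ∣_) aₙ≡pc q∣aₙ)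
        ... | inj₁ q∣p = prime-divisor≡ p-prime q∣p (prime⇒2≤ q-prime)
        ... | inj₂ q∣c = contradiction q∣c q∤c

    small-term-in-window : ∀ {n} → 2 ≤ n → suc (C + n) ≤ horizon C →
                           ∃[ j ] j < suc C × a (suc (j + n)) < C * C
    small-term-in-window {n} 2≤n end≤h =
      decidable-stable (anyUpTo? (λ j → a (suc (j + n)) <? C * C) (suc C))
        (λ none → all-large⇒⊥ (λ j<1+C → ≮⇒≥ (λ aⱼ<C² → none (_ , j<1+C , aⱼ<C²))))
      where
        all-large⇒⊥ : (∀ {j} → j < suc C → C * C ≤ a (suc (j + n))) → ⊥
        all-large⇒⊥ large with p , p-prime , p∣aₙ₊₁ , p∣aₙ ← ∃-prime-shared-with-next 2≤n
          = pigeonhole C (λ j c → a (suc (j + n)) ≡ p * c)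
              (λ j j≤C → multiple (s≤s j≤C))
              (λ _ _ eᵢ eⱼ → +-cancelʳ-≡ n _ _
                 (suc-injective (a-injective (s≤s z≤n) (s≤s z≤n) (trans eᵢ (sym eⱼ)))))
          where
            multiple : ∀ {j} → j < suc C → SmallMultiple p (a (suc (j + n)))
            multiple {zero} _ =
              ∣∧<⇒SmallMultiple p∣aₙ₊₁
                (next<q*C 2≤n (≤-trans (s≤s (m≤n+m n C)) end≤h) (prime⇒2≤ p-prime) p∣aₙ)
            multiple {suc j} (s≤s j<C) =
              prime-persists p-prime (≤-trans 2≤n (m≤n+m n (suc j)))
                (≤-trans (s≤s (+-monoˡ-≤ n j<C)) end≤h)
                (large (m<n⇒m<1+n j<C)) (large (s≤s j<C)) (multiple (m<n⇒m<1+n j<C))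

    window-end≤horizon : ∀ {k} → k ≤ C * C → suc (C + (2 + k * suc C)) ≤ horizon C
    window-end≤horizon {k} k≤C² = begin
      suc (C + (2 + k * suc C))  ≡⟨ cong suc (+-comm C (2 + k * suc C)) ⟩
      3 + (k * suc C + C)        ≤⟨ +-monoʳ-≤ 3 (+-monoʳ-≤ (k * suc C) (n≤1+n C)) ⟩
      3 + (k * suc C + suc C)    ≡⟨ cong (3 +_) (+-comm (k * suc C) (suc C)) ⟩
      3 + suc k * suc C          ≤⟨ +-monoʳ-≤ 3 (*-monoˡ-≤ (suc C) (s≤s k≤C²)) ⟩
      horizon C                  ∎
      where open ≤-Reasoning

    window-injective : ∀ {k k' j j'} → j < suc C → j' < suc C →
                       j + (2 + k * suc C) ≡ j' + (2 + k' * suc C) → k ≡ k'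
    window-injective {k} {k'} {j} {j'} j<1+C j'<1+C eq = begin
      k                         ≡⟨ sym ([m*n+o]/n≡m k j<1+C) ⟩
      (k * suc C + j) / suc C   ≡⟨ cong (_/ suc C) (+-cancelˡ-≡ 2 _ _ shifted) ⟩
      (k' * suc C + j') / suc C ≡⟨ [m*n+o]/n≡m k' j'<1+C ⟩
      k'                        ∎
      where
        open ≡-Reasoning
        shifted : 2 + (k * suc C + j) ≡ 2 + (k' * suc C + j')
        shifted = trans (sym (+-comm j (2 + k * suc C))) (trans eq (+-comm j' (2 + k' * suc C)))

    -- Window k consists of the terms a(3 + k(C+1) + j) with j ≤ C.
    windows-collide : ⊥
    windows-collide =
      pigeonhole (C * C) (λ k v → ∃[ j ] j < suc C × a (suc (j + (2 + k * suc C))) ≡ v)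
        (λ k k≤C² →
           let (j , j<1+C , aⱼ<C²) = small-term-in-window (s≤s (s≤s z≤n)) (window-end≤horizon k≤C²)
           in _ , aⱼ<C² , j , j<1+C , refl)
        (λ { _ _ (j , j<1+C , eq) (j' , j'<1+C , eq') → window-injective j<1+C j'<1+C
               (suc-injective (a-injective (s≤s z≤n) (s≤s z≤n) (trans eq (sym eq')))) })

  ∃-large-even-term : ∀ C .{{_ : NonZero C}} → 2 ∣ C → ∃[ i ] 1 ≤ i × 2 ∣ a i × C ≤ a i
  ∃-large-even-term C 2∣C =
    map₂ proj₂ (decidable-stable (anyUpTo? large-even? (suc (horizon C))) none⇒⊥)
    where
      large-even? : ∀ i → Dec (1 ≤ i × 2 ∣ a i × C ≤ a i)
      large-even? i = (1 ≤? i) ×-dec ((2 ∣? a i) ×-dec (C ≤? a i))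
      none⇒⊥ : ¬ ¬ (∃[ i ] i < suc (horizon C) × 1 ≤ i × 2 ∣ a i × C ≤ a i)
      none⇒⊥ none = SmallEvenTerms.windows-collide C 2∣C
        (λ {i} 1≤i i≤h 2∣aᵢ → ≰⇒> (λ C≤aᵢ → none (i , s≤s i≤h , 1≤i , 2∣aᵢ , C≤aᵢ)))

  larger-even-term : ∀ x → ∃[ i ] 1 ≤ i × 2 ∣ a i × x < a i
  larger-even-term x =
    map₂ (map₂ (map₂ (<-≤-trans (m≤m+n (suc x) (suc x + 0)))))
      (∃-large-even-term (2 * suc x) (m∣m*n (suc x)))

  even-index : ℕ → ℕ
  even-index zero    = 2
  even-index (suc j) = proj₁ (larger-even-term (a (even-index j)))

  even-index-even : ∀ j → 1 ≤ even-index j × 2 ∣ a (even-index j)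
  even-index-even zero    = s≤s z≤n , subst (2 ∣_) (sym a[2]≡2) ∣-refl
  even-index-even (suc j) =
    let (_ , 1≤i , 2∣aᵢ , _) = larger-even-term (a (even-index j)) in 1≤i , 2∣aᵢ

  even-index-increasing : ∀ j → a (even-index j) < a (even-index (suc j))
  even-index-increasing j = proj₂ (proj₂ (proj₂ (larger-even-term (a (even-index j)))))

  2-divides-infinitely-often : DividesInfinitelyOften 2
  2-divides-infinitely-often = record
    { index           = even-index
    ; index-injective = step-increasing⇒injective (a ∘ even-index) even-index-increasing ∘ cong a
    ; 2≤index         = λ j → even-index≥2 (proj₁ (even-index-even j)) (proj₂ (even-index-even j))
    ; p∣a[index]      = proj₂ ∘ even-index-even
    }

  evens-occur : ∀ {m} → 1 ≤ m → 2 ∣ m → Occurs a m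
  evens-occur = multiples-occur ≤-refl 2-divides-infinitely-often

  divides-infinitely-often : ∀ k → DividesInfinitelyOften (suc k)
  divides-infinitely-often k = record
    { index           = index
    ; index-injective = λ {i} {j} eq → suc-injective (*-cancelˡ-≡ (suc i) (suc j) (suc k)
                          (*-cancelˡ-≡ _ _ 2
                            (trans (sym (a[index]≡value i)) (trans (cong a eq) (a[index]≡value j)))))
    ; 2≤index         = λ j → even-index≥2 (1≤index j)
                          (subst (2 ∣_) (sym (a[index]≡value j)) (m∣m*n (suc k * suc j)))
    ; p∣a[index]      = λ j → subst (suc k ∣_) (sym (a[index]≡value j))
                          (∣-trans (m∣m*n (suc j)) (n∣m*n 2))
    }
    where
      value : ℕ → ℕ
      value j = 2 * (suc k * suc j)
      even-multiple : ∀ j → Occurs a (value j)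
      even-multiple j = evens-occur (s≤s z≤n) (m∣m*n (suc k * suc j))
      index : ℕ → ℕ
      index = proj₁ ∘ even-multiple
      1≤index : ∀ j → 1 ≤ index j
      1≤index = proj₁ ∘ proj₂ ∘ even-multiple
      a[index]≡value : ∀ j → a (index j) ≡ value j
      a[index]≡value = proj₂ ∘ proj₂ ∘ even-multiple

  every-positive-occurs : ∀ {k} → 1 ≤ k → Occurs a k
  every-positive-occurs {suc zero}    _ = 1 , ≤-refl , a[1]≡1
  every-positive-occurs {suc (suc k)} _ =
    multiples-occur (s≤s (s≤s z≤n)) (divides-infinitely-often (suc k)) (s≤s z≤n) ∣-refl

mainTheorem1 : (a : ℕ → ℕ) → IsEKG a → (k : ℕ) → 1 ≤ k → ∃[ n ] (1 ≤ n × a n ≡ k)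
mainTheorem1 a ekg k = EKG.every-positive-occurs a ekg
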